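{- Let $n\ge 3$ be odd, let $k\ge 1$ be an integer, and let $r$ be an odd integer with $1\le r<n$. Let $G(n;k,r)$ be the unicyclic graph consisting of a cycle $C_n$ with vertices $a_1,a_2,\dots,a_n$ (in cyclic order), together with $k_i$ pendant vertices attached to $a_i$ for each $1\le i\le n$, where $k_r=k_{n-r}=k+1$ and $k_i=k$ for $i\notin\{r,n-r\}$ (so $G(n;k,r)$ has $p=q=n(k+1)+2$ vertices and edges). Then $G(n;k,r)$ admits a super edge-magic total labeling and $$sm(G(n;k,r))=2n(k+1)+4+\frac{n+3}{2}.$$
   Context: All graphs are finite, simple and undirected. For a graph $G$ with $p$ vertices and $q$ edges, a super edge-magic total labeling is a bijection $f\colon V(G)\cup E(G)\to\{1,2,\dots,p+q\}$ with $f(V(G))=\{1,\dots,p\}$ such that $f(u)+f(v)+f(uv)$ equals a constant $c(f)$ (the magic constant) for every edge $uv\in E(G)$. $G$ is super edge-magic total if it admits such a labeling, and its super edge-magic total strength $sm(G)$ is the minimum of $c(f)$ over all super edge-magic total labelings $f$ of $G$. -}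

module Defs where

open import Data.Nat using (ℕ; zero; suc; _+_; _*_; _∸_; _<_; _≤_; _≟_)
open import Data.Fin using (Fin; toℕ)
open import Data.Fin as F using ()
open import Data.Sum using (_⊎_; inj₁; inj₂)
open import Data.Product using (Σ; _×_; _,_; proj₁; proj₂)
open import Data.Bool using (Bool; true; false; _∨_)
open import Relation.Nullary.Decidable using (⌊_⌋)
open import Relation.Binary.PropositionalEquality using (_≡_)
open import Function.Bundles using (_⤖_; module Bijection)
open import Relation.Nullary using (¬_)
open import Data.Nat.DivMod using (_%_; m%n<n)

-- A finite graph given by a type of vertices, a type of edges, and the
-- two endpoints of every edge.  (Finiteness/simplicity of the concrete graph
-- below is evident from its construction; a labeling as defined below can
-- only exist when V and E are finite.)
record Graph : Set₁ where
  field
    V    : Set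
    E    : Set
    ends : E → V × V

open Graph public

-- The labeling is a bijection  f : V ⊎ E → {1,…,p+q},  encoded
-- as a bijection onto Fin (p + q) with label  x ↦ 1 + toℕ (f x).
-- The condition f(V) = {1,…,p} is:  a label is ≤ p iff it is a vertex label.
record SEMTLabeling (G : Graph) (c : ℕ) : Set where
  field
    p q : ℕ
    f   : (V G ⊎ E G) ⤖ Fin (p + q)

  label : V G ⊎ E G → ℕ
  label x = suc (toℕ (Bijection.to f x))

  field
    vertices-low : ∀ x → (label x ≤ p) → Σ (V G) (λ v → x ≡ inj₁ v)
    low-vertices : ∀ v → label (inj₁ v) ≤ p
    magic        : ∀ e → label (inj₁ (proj₁ (ends G e))) + label (inj₁ (proj₂ (ends G e)))
                           + label (inj₂ e) ≡ c

SuperEdgeMagicTotal : Graph → Set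
SuperEdgeMagicTotal G = Σ ℕ (SEMTLabeling G)

SMStrength : Graph → ℕ → Set
SMStrength G s = SEMTLabeling G s × (∀ c → SEMTLabeling G c → s ≤ c)

-- Cycle vertex a_i (1 ≤ i ≤ n) is represented
-- by i' : Fin n with toℕ i' = i - 1.  Number of pendants at a_i:
--   k_i = k + 1  if i = r or i = n - r,   k_i = k  otherwise.
pendants : (n k r : ℕ) → Fin n → ℕ
pendants n k r i with ⌊ suc (toℕ i) ≟ r ⌋ ∨ ⌊ suc (toℕ i) ≟ n ∸ r ⌋
... | true  = suc k
... | false = k

next : {n : ℕ} → Fin n → Fin n
next {suc m} i = F.fromℕ< (m%n<n (suc (toℕ i)) (suc m))

GraphNKR : (n k r : ℕ) → Graph
GraphNKR n k r = record
  { V    = Fin n ⊎ Σ (Fin n) (λ i → Fin (pendants n k r i))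
  ; E    = Fin n ⊎ Σ (Fin n) (λ i → Fin (pendants n k r i))
  ; ends = λ { (inj₁ i) → inj₁ i , inj₁ (next i)
             ; (inj₂ (i , j)) → inj₁ i , inj₂ (i , j) }
  }

-- Write n = 2m + 1 and r = 2j + 1, so n − r = 2e + 2 with m = j + e + 1.  Walking around the cycle, label its
-- vertices 1, m + 2, 2, m + 3, …, m + 1: the label after x is its rotation by m + 1 modulo n, and the n cycle
-- edges get the consecutive sums m + 2, …, 3m + 2.  The pendants are labelled layer by layer (layer t holds the
-- t-th pendant of every cycle vertex) so that both the vertex labels and the edge sums fill consecutive intervals;
-- in layer 0 this needs two gaps, filled exactly by the extra pendants at a_r and a_{n−r}.  With p = q = L, sums
-- ending at m + 1 + L give a super edge-magic total labelling with constant 2L + m + 2.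
--
-- Conversely, charge each pendant edge to its pendant and the cycle edge a_i a_{i+1} to a_i.  Summing the magic
-- equation over all L edges, the edges and their charged endpoints carry all 2L labels, while the remaining
-- endpoints run at least k + 1 times through the cycle, so L c ≥ L (2L + 1) + (k + 1) n (n + 1) / 2 > L (2L + m + 1).

module Submission where

open import Defs
open import Data.Nat using (ℕ; _+_; _*_; _≤_; _<_; _/_; suc)
open import Data.Nat.Divisibility using (_∣_)
open import Data.Product using (_×_)
open import Relation.Nullary using (¬_)

open import Data.Nat
open import Data.Nat.Properties
open import Data.Nat.DivMod using (_%_; m<n⇒m%n≡m; n%n≡0; m*n/n≡m)
open import Data.Nat.Divisibility using (divides)
open import Data.Nat.ListAction using (sum)
open import Data.Nat.ListAction.Properties using (sum-++; sum-↭)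
open import Data.Nat.Tactic.RingSolver
open import Data.Fin using (Fin; toℕ; fromℕ<; inject≤; punchOut) renaming (zero to fzero; suc to fsuc)
open import Data.Fin.Properties
  using (toℕ-fromℕ<; toℕ-injective; toℕ<n; toℕ-inject≤; punchOut-injective; injective⇒≤; +↔⊎; *↔×; any?) renaming (_≟_ to _≟ᶠ_)
open import Data.Product using (Σ; ∃; _,_; proj₁; proj₂)
open import Data.Sum using (_⊎_; inj₁; inj₂; [_,_])
open import Data.Sum.Properties using (inj₁-injective; inj₂-injective)
open import Data.Sum.Function.Propositional using (_⊎-↔_)
open import Data.List using (List; []; _∷_; _++_; length; map; allFin; cartesianProduct)
open import Data.List.Properties using (length-map; length-++; length-tabulate; map-++; map-∘)
open import Data.List.Relation.Unary.All using (All; []; _∷_; universal)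
import Data.List.Relation.Unary.All.Properties as All
open import Data.List.Relation.Unary.Any using () renaming (any? to anyₗ?)
open import Data.List.Relation.Unary.AllPairs using (_∷_)
open import Data.List.Relation.Unary.Unique.Propositional using (Unique)
import Data.List.Relation.Unary.Unique.Propositional.Properties as Unique
open import Data.List.Membership.Propositional using (_∈_)
open import Data.List.Membership.Propositional.Properties using (∈-∃++; ∈-map⁻)
open import Data.List.Relation.Binary.Permutation.Propositional using (_↭_; ↭⇒↭ₛ)
open import Data.List.Relation.Binary.Permutation.Propositional.Properties using (shift; ↭-length; All-resp-↭)
import Data.List.Relation.Binary.Permutation.Setoid.Properties as Perm
open import Data.Empty using (⊥-elim)
open import Function using (_∘_)
open import Function.Bundles using (_↔_; _⤖_; mk⤖; mk↔ₛ′; Inverse; Bijection)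
open import Function.Definitions using (Injective)
open import Function.Properties.Inverse using (↔-refl; ↔-sym; ↔-trans)
open import Relation.Nullary using (Dec; yes; no; contradiction)
open import Relation.Binary using (tri<; tri≈; tri>)
open import Relation.Binary.PropositionalEquality hiding ([_])
open import Algebra.Properties.CommutativeSemigroup +-commutativeSemigroup using (x∙yz≈y∙xz; xy∙z≈yz∙x; xy∙z≈zy∙x; interchange)
open import Algebra.Properties.CommutativeSemigroup *-commutativeSemigroup using () renaming (x∙yz≈y∙xz to *-left-comm)

data ParityView : ℕ → Set where
  even : ∀ u → ParityView (u + u)
  odd  : ∀ u → ParityView (suc (u + u))

parityView : ∀ p → ParityView p
parityView zero = even 0
parityView (suc zero) = odd 0
parityView (suc (suc p)) with parityView p
... | even u = subst ParityView (cong suc (+-suc u u)) (even (suc u))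
... | odd u = subst ParityView (cong (λ w → suc (suc w)) (+-suc u u)) (odd (suc u))

double≡*2 : ∀ u → u + u ≡ u * 2
double≡*2 u = trans (cong (u +_) (sym (+-identityʳ u))) (*-comm 2 u)

odd≢even : ∀ u v → suc (u + u) ≢ v + v
odd≢even u v eq = even≢odd v u (trans (*-comm 2 v) (trans (sym (double≡*2 v)) (trans (sym eq) (cong suc (trans (double≡*2 u) (*-comm u 2))))))

double-cancel-≤ : ∀ {u v} → u + u ≤ v + v → u ≤ v
double-cancel-≤ {u} {v} le with u ≤? v
... | yes u≤v = u≤v
... | no u≰v = ⊥-elim (<⇒≱ (+-mono-< (≰⇒> u≰v) (≰⇒> u≰v)) le)

double-cancel-< : ∀ {u v} → u + u < v + v → u < v
double-cancel-< {u} {v} lt with u <? v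
... | yes u<v = u<v
... | no u≮v = ⊥-elim (<⇒≱ lt (+-mono-≤ (≮⇒≥ u≮v) (≮⇒≥ u≮v)))

double-injective : ∀ {u v} → u + u ≡ v + v → u ≡ v
double-injective eq = ≤-antisym (double-cancel-≤ (≤-reflexive eq)) (double-cancel-≤ (≤-reflexive (sym eq)))

InRange : ℕ → ℕ → Set
InRange B x = 1 ≤ x × x ≤ B

Unique-resp-↭ : ∀ {xs ys : List ℕ} → xs ↭ ys → Unique xs → Unique ys
Unique-resp-↭ p = Perm.Unique-resp-↭ (setoid ℕ) (↭⇒↭ₛ p)

private
  InRange-pred : ∀ {B} xs → All (InRange (suc B)) xs → All (suc B ≢_) xs → All (InRange B) xs
  InRange-pred [] [] [] = []
  InRange-pred (x ∷ xs) ((1≤x , x≤1+B) ∷ rs) (x≢ ∷ ns) = (1≤x , ≤-pred (≤∧≢⇒< x≤1+B (x≢ ∘ sym))) ∷ InRange-pred xs rs ns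

  triangular-step : ∀ {N B S} → N ≤ B → N * suc N ≤ 2 * S → suc N * suc (suc N) ≤ 2 * (suc B + S)
  triangular-step {N} {B} {S} N≤B bound = begin
    suc N * suc (suc N)       ≡⟨ identity N ⟩
    2 * suc N + N * suc N     ≤⟨ +-mono-≤ (*-monoʳ-≤ 2 (s≤s N≤B)) bound ⟩
    2 * suc B + 2 * S         ≡⟨ sym (*-distribˡ-+ 2 (suc B) S) ⟩
    2 * (suc B + S)           ∎
    where
    open ≤-Reasoning
    identity : ∀ N → suc N * suc (suc N) ≡ 2 * suc N + N * suc N
    identity = solve-∀

  -- induction on B, removing B from xs; the bound length xs ≤ B is what the step needs
  length-and-sum : ∀ B xs → Unique xs → All (InRange B) xs → length xs ≤ B × length xs * suc (length xs) ≤ 2 * sum xs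
  length-and-sum zero [] _ [] = z≤n , z≤n
  length-and-sum zero (x ∷ _) _ ((1≤x , x≤0) ∷ _) = ⊥-elim (<-irrefl refl (≤-trans 1≤x x≤0))
  length-and-sum (suc B) xs u rs with anyₗ? (suc B ≟_) xs
  ... | no ∉ = let (N≤B , bound) = length-and-sum B xs u (InRange-pred xs rs (All.¬Any⇒All¬ xs ∉)) in m≤n⇒m≤1+n N≤B , bound
  ... | yes ∈ with us , vs , refl ← ∈-∃++ ∈ = step (Unique-resp-↭ xs↭ u) (All-resp-↭ xs↭ rs)
    where
    xs↭ : us ++ suc B ∷ vs ↭ suc B ∷ us ++ vs
    xs↭ = shift (suc B) us vs
    step : Unique (suc B ∷ us ++ vs) → All (InRange (suc B)) (suc B ∷ us ++ vs) →
           length (us ++ suc B ∷ vs) ≤ suc B × length (us ++ suc B ∷ vs) * suc (length (us ++ suc B ∷ vs)) ≤ 2 * sum (us ++ suc B ∷ vs)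
    step (B∉ ∷ u′) (_ ∷ rs′) rewrite ↭-length xs↭ | sum-↭ xs↭ =
      let (N≤B , bound) = length-and-sum B (us ++ vs) u′ (InRange-pred (us ++ vs) rs′ B∉)
      in s≤s N≤B , triangular-step N≤B bound

distinct-sum-bound : ∀ B xs → Unique xs → All (InRange B) xs → length xs * suc (length xs) ≤ 2 * sum xs
distinct-sum-bound B xs u rs = proj₂ (length-and-sum B xs u rs)

sumMap : ∀ {A : Set} → (A → ℕ) → List A → ℕ
sumMap f xs = sum (map f xs)

sumMap-+ : ∀ {A : Set} (f g : A → ℕ) xs → sumMap (λ x → f x + g x) xs ≡ sumMap f xs + sumMap g xs
sumMap-+ f g [] = refl
sumMap-+ f g (x ∷ xs) = trans (cong (f x + g x +_) (sumMap-+ f g xs)) (interchange (f x) (g x) _ _)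

sumMap-const : ∀ {A : Set} c (xs : List A) → sumMap (λ _ → c) xs ≡ length xs * c
sumMap-const c [] = refl
sumMap-const c (x ∷ xs) = cong (c +_) (sumMap-const c xs)

sumMap-cong : ∀ {A : Set} {f g : A → ℕ} xs → (∀ x → f x ≡ g x) → sumMap f xs ≡ sumMap g xs
sumMap-cong [] eq = refl
sumMap-cong (x ∷ xs) eq = cong₂ _+_ (eq x) (sumMap-cong xs eq)

sumMap-++ : ∀ {A : Set} (f : A → ℕ) xs ys → sumMap f (xs ++ ys) ≡ sumMap f xs + sumMap f ys
sumMap-++ f xs ys = trans (cong sum (map-++ f xs ys)) (sum-++ (map f xs) (map f ys))

length-cartesianProduct : ∀ {A B : Set} (xs : List A) (ys : List B) → length (cartesianProduct xs ys) ≡ length xs * length ys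
length-cartesianProduct [] ys = refl
length-cartesianProduct (x ∷ xs) ys = trans (length-++ (map (x ,_) ys)) (cong₂ _+_ (length-map (x ,_) ys) (length-cartesianProduct xs ys))

sumMap-map : ∀ {A B : Set} (f : B → ℕ) (g : A → B) xs → sumMap f (map g xs) ≡ sumMap (f ∘ g) xs
sumMap-map f g xs = cong sum (sym (map-∘ xs))

sumMap-map-++ : ∀ {A B C : Set} (f : C → ℕ) (g : A → C) (h : B → C) xs ys → sumMap f (map g xs ++ map h ys) ≡ sumMap (f ∘ g) xs + sumMap (f ∘ h) ys
sumMap-map-++ f g h xs ys = trans (sumMap-++ f (map g xs) (map h ys)) (cong₂ _+_ (sumMap-map f g xs) (sumMap-map f h ys))

length-map-++ : ∀ {A B C : Set} (f : A → C) (g : B → C) xs ys → length (map f xs ++ map g ys) ≡ length xs + length ys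
length-map-++ f g xs ys = trans (length-++ (map f xs)) (cong₂ _+_ (length-map f xs) (length-map g ys))

sumMap-cartesianProduct : ∀ {A B : Set} (f : A → ℕ) (xs : List A) (ys : List B) → sumMap (f ∘ proj₁) (cartesianProduct xs ys) ≡ length ys * sumMap f xs
sumMap-cartesianProduct f [] ys = sym (*-zeroʳ (length ys))
sumMap-cartesianProduct f (x ∷ xs) ys = begin
  sumMap (f ∘ proj₁) (map (x ,_) ys ++ cartesianProduct xs ys)
    ≡⟨ sumMap-++ (f ∘ proj₁) (map (x ,_) ys) _ ⟩
  sumMap (f ∘ proj₁) (map (x ,_) ys) + sumMap (f ∘ proj₁) (cartesianProduct xs ys)
    ≡⟨ cong₂ _+_ (trans (sumMap-map (f ∘ proj₁) (x ,_) ys) (sumMap-const (f x) ys)) (sumMap-cartesianProduct f xs ys) ⟩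
  length ys * f x + length ys * sumMap f xs
    ≡⟨ sym (*-distribˡ-+ (length ys) (f x) _) ⟩
  length ys * sumMap f (x ∷ xs) ∎
  where open ≡-Reasoning

length-allFin : ∀ N → length (allFin N) ≡ N
length-allFin N = length-tabulate (λ i → i)

distinct-sum-bound-Fin : ∀ {N B} (h : Fin N → ℕ) → Injective _≡_ _≡_ h → (∀ i → InRange B (h i)) → N * suc N ≤ 2 * sumMap h (allFin N)
distinct-sum-bound-Fin {N} {B} h h-injective h-range = subst (λ l → l * suc l ≤ 2 * sumMap h (allFin N)) length≡N
  (distinct-sum-bound B (map h (allFin N)) (Unique.map⁺ h-injective (Unique.allFin⁺ N)) (All.map⁺ (universal h-range (allFin N))))
  where
  length≡N : length (map h (allFin N)) ≡ N
  length≡N = trans (length-map h (allFin N)) (length-allFin N)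

injective⇒surjective : ∀ {N} (h : Fin N → Fin N) → Injective _≡_ _≡_ h → ∀ y → ∃ λ x → h x ≡ y
injective⇒surjective {suc N} h inj y with any? (λ x → h x ≟ᶠ y)
... | yes found = found
... | no missed = ⊥-elim (<-irrefl refl (injective⇒≤ {f = h′} h′-injective))
  where
  y≢h : ∀ x → y ≢ h x
  y≢h x eq = missed (x , sym eq)
  h′ : Fin (suc N) → Fin N
  h′ x = punchOut (y≢h x)
  h′-injective : Injective _≡_ _≡_ h′
  h′-injective eq = inj (punchOut-injective (y≢h _) (y≢h _) eq)

injective⇒bijection : ∀ {A : Set} {N} → A ↔ Fin N → (h : A → Fin N) → Injective _≡_ _≡_ h → A ⤖ Fin N
injective⇒bijection {N = N} A↔ h inj = mk⤖ (inj , surjective)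
  where
  open Inverse A↔ using (to; from; inverseˡ)
  surjective : ∀ y → ∃ λ x → ∀ {z} → z ≡ x → h z ≡ y
  surjective y with x , hx≡y ← injective⇒surjective (h ∘ from) (λ eq → trans (sym (inverseˡ refl)) (trans (cong to (inj eq)) (inverseˡ refl))) y
    = from x , λ { refl → hx≡y }

edgeSum : (G : Graph) → (V G → ℕ) → E G → ℕ
edgeSum G ℓ e = ℓ (proj₁ (ends G e)) + ℓ (proj₂ (ends G e))

-- A labelling of the vertices by 1, …, p whose q edge sums are consecutive, the largest being M, extends to a
-- super edge-magic total labelling: the edge with sum σ gets the label p + 1 + (M − σ).
module _ (G : Graph) {p q : ℕ} (V↔ : V G ↔ Fin p) (E↔ : E G ↔ Fin q)
         (ℓ : V G → ℕ) (ℓ-range : ∀ v → InRange p (ℓ v)) (ℓ-injective : Injective _≡_ _≡_ ℓ)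
         (M : ℕ) (σ-range : ∀ e → edgeSum G ℓ e ≤ M × M < edgeSum G ℓ e + q)
         (σ-injective : Injective _≡_ _≡_ (edgeSum G ℓ)) where

  private
    σ = edgeSum G ℓ

    suc-pred-ℓ : ∀ v → suc (pred (ℓ v)) ≡ ℓ v
    suc-pred-ℓ v = suc-pred (ℓ v) {{>-nonZero (proj₁ (ℓ-range v))}}

    edgeOffset< : ∀ e → M ∸ σ e < q
    edgeOffset< e = +-cancelʳ-< (σ e) (M ∸ σ e) q (begin-strict
      M ∸ σ e + σ e  ≡⟨ m∸n+n≡m (proj₁ (σ-range e)) ⟩
      M              <⟨ proj₂ (σ-range e) ⟩
      σ e + q        ≡⟨ +-comm (σ e) q ⟩
      q + σ e        ∎)
      where open ≤-Reasoning

    index : V G ⊎ E G → Fin (p + q)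
    index (inj₁ v) = fromℕ< (≤-trans (subst (_≤ p) (sym (suc-pred-ℓ v)) (proj₂ (ℓ-range v))) (m≤m+n p q))
    index (inj₂ e) = fromℕ< (+-monoʳ-< p (edgeOffset< e))

    label-vertex : ∀ v → suc (toℕ (index (inj₁ v))) ≡ ℓ v
    label-vertex v = trans (cong suc (toℕ-fromℕ< _)) (suc-pred-ℓ v)

    label-edge : ∀ e → suc (toℕ (index (inj₂ e))) ≡ suc (p + (M ∸ σ e))
    label-edge e = cong suc (toℕ-fromℕ< _)

    vertex<edge : ∀ v e → ℓ v < suc (p + (M ∸ σ e))
    vertex<edge v e = s≤s (≤-trans (proj₂ (ℓ-range v)) (m≤m+n p _))

    index-injective : Injective _≡_ _≡_ index
    index-injective {inj₁ v} {inj₁ w} eq = cong inj₁ (ℓ-injective (begin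
      ℓ v                       ≡⟨ sym (label-vertex v) ⟩
      suc (toℕ (index (inj₁ v))) ≡⟨ cong (suc ∘ toℕ) eq ⟩
      suc (toℕ (index (inj₁ w))) ≡⟨ label-vertex w ⟩
      ℓ w                       ∎))
      where open ≡-Reasoning
    index-injective {inj₂ e} {inj₂ f} eq = cong inj₂ (σ-injective (∸-cancelˡ-≡ (proj₁ (σ-range e)) (proj₁ (σ-range f))
      (+-cancelˡ-≡ p _ _ (suc-injective (trans (sym (label-edge e)) (trans (cong (suc ∘ toℕ) eq) (label-edge f)))))))
    index-injective {inj₁ v} {inj₂ e} eq = ⊥-elim (<⇒≢ (vertex<edge v e) (trans (sym (label-vertex v)) (trans (cong (suc ∘ toℕ) eq) (label-edge e))))
    index-injective {inj₂ e} {inj₁ v} eq = ⊥-elim (<⇒≢ (vertex<edge v e) (trans (sym (label-vertex v)) (trans (cong (suc ∘ toℕ) (sym eq)) (label-edge e))))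

  semt-from-consecutive-sums : SEMTLabeling G (suc (p + M))
  semt-from-consecutive-sums = record
    { p = p
    ; q = q
    ; f = injective⇒bijection (↔-trans (V↔ ⊎-↔ E↔) (↔-sym +↔⊎)) index index-injective
    ; vertices-low = λ
        { (inj₁ v) _ → v , refl
        ; (inj₂ e) ≤p → ⊥-elim (<-irrefl refl (≤-trans (s≤s (m≤m+n p _)) (subst (_≤ p) (label-edge e) ≤p))) }
    ; low-vertices = λ v → subst (_≤ p) (sym (label-vertex v)) (proj₂ (ℓ-range v))
    ; magic = λ e → begin
        suc (toℕ (index (inj₁ (proj₁ (ends G e))))) + suc (toℕ (index (inj₁ (proj₂ (ends G e))))) + suc (toℕ (index (inj₂ e)))
          ≡⟨ cong₂ _+_ (cong₂ _+_ (label-vertex _) (label-vertex _)) (label-edge e) ⟩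
        σ e + suc (p + (M ∸ σ e))  ≡⟨ +-suc (σ e) _ ⟩
        suc (σ e + (p + (M ∸ σ e))) ≡⟨ cong suc (x∙yz≈y∙xz (σ e) p _) ⟩
        suc (p + (σ e + (M ∸ σ e))) ≡⟨ cong (λ x → suc (p + x)) (m+[n∸m]≡n (proj₁ (σ-range e))) ⟩
        suc (p + M)  ∎
    }
    where open ≡-Reasoning

label-injective : ∀ {G c} (lab : SEMTLabeling G c) → Injective _≡_ _≡_ (SEMTLabeling.label lab)
label-injective lab eq = Bijection.injective (SEMTLabeling.f lab) (toℕ-injective (suc-injective eq))

label-range : ∀ {G c} (lab : SEMTLabeling G c) x → InRange (SEMTLabeling.p lab + SEMTLabeling.q lab) (SEMTLabeling.label lab x)
label-range lab x = s≤s z≤n , toℕ<n (Bijection.to (SEMTLabeling.f lab) x)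

-- Charge every edge to an endpoint of its own; the labels of distinct edges and of their own endpoints
-- are then 2N distinct labels, so they sum to at least 1 + ⋯ + 2N.
module _ {G : Graph} {c : ℕ} (lab : SEMTLabeling G c) (own other : E G → V G)
         (own-injective : Injective _≡_ _≡_ own)
         (ends≡ : ∀ e → ends G e ≡ (own e , other e) ⊎ ends G e ≡ (other e , own e)) where
  open SEMTLabeling lab

  private
    magic′ : ∀ e → label (inj₂ e) + label (inj₁ (own e)) + label (inj₁ (other e)) ≡ c
    magic′ e with ends G e | ends≡ e | magic e
    ... | _ | inj₁ refl | eq = trans (xy∙z≈yz∙x (label (inj₂ e)) _ _) eq
    ... | _ | inj₂ refl | eq = trans (xy∙z≈zy∙x (label (inj₂ e)) _ _) eq

    ownElements : List (E G) → List (V G ⊎ E G)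
    ownElements es = map inj₂ es ++ map (inj₁ ∘ own) es

    ownElements-unique : ∀ es → Unique es → Unique (ownElements es)
    ownElements-unique es u = Unique.++⁺ (Unique.map⁺ inj₂-injective u) (Unique.map⁺ (own-injective ∘ inj₁-injective) u) disjoint
      where
      disjoint : ∀ {x} → ¬ (x ∈ map inj₂ es × x ∈ map (inj₁ ∘ own) es)
      disjoint (∈₂ , ∈₁) with ∈-map⁻ inj₂ ∈₂ | ∈-map⁻ (inj₁ ∘ own) ∈₁
      ... | _ , _ , refl | _ , _ , ()

    ownElements-sum : ∀ es → sumMap label (ownElements es) ≡ sumMap (λ e → label (inj₂ e) + label (inj₁ (own e))) es
    ownElements-sum es = trans (sumMap-map-++ label inj₂ (inj₁ ∘ own) es es) (sym (sumMap-+ (label ∘ inj₂) (label ∘ inj₁ ∘ own) es))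

    ownElements-length : ∀ es → length (map label (ownElements es)) ≡ length es + length es
    ownElements-length es = trans (length-map label (ownElements es)) (length-map-++ inj₂ (inj₁ ∘ own) es es)

    ownElements-bound : ∀ es → Unique es → length es * suc (2 * length es) ≤ sumMap label (ownElements es)
    ownElements-bound es u = *-cancelˡ-≤ 2 (begin
      2 * (N * suc (2 * N))               ≡⟨ double N ⟩
      (N + N) * suc (N + N)               ≡⟨ cong (λ x → x * suc x) (sym (ownElements-length es)) ⟩
      length ls * suc (length ls)         ≤⟨ distinct-sum-bound (p + q) ls (Unique.map⁺ (label-injective lab) (ownElements-unique es u))
                                                                   (All.map⁺ (universal (label-range lab) _)) ⟩
      2 * sum ls                          ∎)
      where
      open ≤-Reasoning
      N = length es
      ls = map label (ownElements es)
      double : ∀ N → 2 * (N * suc (2 * N)) ≡ (N + N) * suc (N + N)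
      double = solve-∀

  magic-lower-bound : (es : List (E G)) → Unique es →
    length es * suc (2 * length es) + sumMap (label ∘ inj₁ ∘ other) es ≤ length es * c
  magic-lower-bound es u = begin
    length es * suc (2 * length es) + sumMap (label ∘ inj₁ ∘ other) es
      ≤⟨ +-monoˡ-≤ _ (ownElements-bound es u) ⟩
    sumMap label (ownElements es) + sumMap (label ∘ inj₁ ∘ other) es
      ≡⟨ cong (_+ _) (ownElements-sum es) ⟩
    sumMap (λ e → label (inj₂ e) + label (inj₁ (own e))) es + sumMap (label ∘ inj₁ ∘ other) es
      ≡⟨ sym (sumMap-+ _ _ es) ⟩
    sumMap (λ e → label (inj₂ e) + label (inj₁ (own e)) + label (inj₁ (other e))) es
      ≡⟨ sumMap-cong es magic′ ⟩
    sumMap (λ _ → c) es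
      ≡⟨ sumMap-const c es ⟩
    length es * c ∎
    where open ≤-Reasoning

module ConsecutiveBlocks (width : ℕ → ℕ) where

  start : ℕ → ℕ
  start zero = zero
  start (suc b) = start b + width b

  Offset : ℕ → ℕ → Set
  Offset b o = 1 ≤ o × o ≤ width b

  start-mono : ∀ {b b′} → b ≤ b′ → start b ≤ start b′
  start-mono {b′ = zero} z≤n = z≤n
  start-mono {b} {suc b′} b≤1+b′ with m≤n⇒m<n∨m≡n b≤1+b′
  ... | inj₂ refl = ≤-refl
  ... | inj₁ b<1+b′ = ≤-trans (start-mono (≤-pred b<1+b′)) (m≤m+n (start b′) (width b′))

  start+offset-range : ∀ {b o B} → b < B → Offset b o → 1 ≤ start b + o × start b + o ≤ start B
  start+offset-range {b} (b<B) (1≤o , o≤w) = ≤-trans 1≤o (m≤n+m _ (start b)) , ≤-trans (+-monoʳ-≤ (start b) o≤w) (start-mono b<B)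

  private
    below-next : ∀ {b b′ o o′} → b < b′ → Offset b o → Offset b′ o′ → start b + o < start b′ + o′
    below-next {b} {b′} b<b′ (_ , o≤w) (1≤o′ , _) = ≤-<-trans (≤-trans (+-monoʳ-≤ (start b) o≤w) (start-mono b<b′)) (m<m+n (start b′) 1≤o′)

  start+offset-injective : ∀ {b b′ o o′} → Offset b o → Offset b′ o′ → start b + o ≡ start b′ + o′ → b ≡ b′ × o ≡ o′
  start+offset-injective {b} {b′} off off′ eq with <-cmp b b′
  ... | tri< b<b′ _ _ = ⊥-elim (<⇒≢ (below-next b<b′ off off′) eq)
  ... | tri> _ _ b′<b = ⊥-elim (<⇒≢ (below-next b′<b off′ off) (sym eq))
  ... | tri≈ _ refl _ = refl , +-cancelˡ-≡ (start b) _ _ eq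

toℕ-next : ∀ {n} (i : Fin (suc n)) → (suc (toℕ i) < suc n × toℕ (next i) ≡ suc (toℕ i)) ⊎ (toℕ i ≡ n × toℕ (next i) ≡ 0)
toℕ-next {n} i with suc (toℕ i) <? suc n
... | yes 1+i<1+n = inj₁ (1+i<1+n , trans (toℕ-fromℕ< _) (m<n⇒m%n≡m 1+i<1+n))
... | no 1+i≮1+n = inj₂ (i≡n , trans (toℕ-fromℕ< _) (trans (cong (λ w → suc w % suc n) i≡n) (n%n≡0 (suc n))))
  where
  i≡n : toℕ i ≡ n
  i≡n = ≤-antisym (≤-pred (toℕ<n i)) (≤-pred (≮⇒≥ 1+i≮1+n))

next-injective : ∀ {n} {i i′ : Fin (suc n)} → next i ≡ next i′ → i ≡ i′
next-injective {n} {i} {i′} eq with toℕ-next i | toℕ-next i′ | cong toℕ eq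
... | inj₁ (_ , e₁) | inj₁ (_ , e₂) | e = toℕ-injective (suc-injective (trans (sym e₁) (trans e e₂)))
... | inj₁ (_ , e₁) | inj₂ (_ , e₂) | e = ⊥-elim (1+n≢0 (trans (sym e₁) (trans e e₂)))
... | inj₂ (_ , e₁) | inj₁ (_ , e₂) | e = ⊥-elim (1+n≢0 (trans (sym e₂) (trans (sym e) e₁)))
... | inj₂ (i≡n , _) | inj₂ (i′≡n , _) | _ = toℕ-injective (trans i≡n (sym i′≡n))

pendants-special : ∀ n k r (i : Fin n) → suc (toℕ i) ≡ r ⊎ suc (toℕ i) ≡ n ∸ r → pendants n k r i ≡ suc k
pendants-special n k r i special with suc (toℕ i) ≟ r | suc (toℕ i) ≟ n ∸ r
... | yes _ | _ = refl
... | no _ | yes _ = refl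
... | no ≢r | no ≢n-r = ⊥-elim ([ ≢r , ≢n-r ] special)

pendants-ordinary : ∀ n k r (i : Fin n) → suc (toℕ i) ≢ r → suc (toℕ i) ≢ n ∸ r → pendants n k r i ≡ k
pendants-ordinary n k r i ≢r ≢n-r with suc (toℕ i) ≟ r | suc (toℕ i) ≟ n ∸ r
... | yes ≡r | _ = ⊥-elim (≢r ≡r)
... | no _ | yes ≡n-r = ⊥-elim (≢n-r ≡n-r)
... | no _ | no _ = refl

-- n = 2m + 1, r = 2j + 1 and k = k′ + 1.  Cycle labels are stored shifted down by one: x < n stands for label x + 1.
module Construction (j e k′ : ℕ) where
  m n k : ℕ
  m = suc (j + e)
  n = suc (m + m)
  k = suc k′

  -- the shifted label following x along the cycle
  rot : ℕ → ℕ
  rot x with x <? m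
  ... | yes _ = suc (m + x)
  ... | no _ = x ∸ m

  τ : ℕ → ℕ
  τ x with x <? m
  ... | yes _ = suc (x + x)
  ... | no _ = (x ∸ m) + (x ∸ m)

  data CycleHalf : ℕ → Set where
    lower : ∀ {x} → x < m → CycleHalf x
    upper : ∀ y → y ≤ m → CycleHalf (m + y)

  cycleHalf : ∀ {x} → x < n → CycleHalf x
  cycleHalf {x} x<n with x <? m
  ... | yes x<m = lower x<m
  ... | no x≮m with y , refl ← m≤n⇒∃[o]m+o≡n (≮⇒≥ x≮m) = upper y (+-cancelˡ-≤ m y m (≤-pred x<n))

  rot-lower : ∀ {x} → x < m → rot x ≡ suc (m + x)
  rot-lower {x} x<m with x <? m
  ... | yes _ = refl
  ... | no x≮m = ⊥-elim (x≮m x<m)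

  rot-upper : ∀ y → rot (m + y) ≡ y
  rot-upper y with m + y <? m
  ... | yes m+y<m = ⊥-elim (m+n≮m m y m+y<m)
  ... | no _ = m+n∸m≡n m y

  τ-lower : ∀ {x} → x < m → τ x ≡ suc (x + x)
  τ-lower {x} x<m with x <? m
  ... | yes _ = refl
  ... | no x≮m = ⊥-elim (x≮m x<m)

  τ-upper : ∀ y → τ (m + y) ≡ y + y
  τ-upper y with m + y <? m
  ... | yes m+y<m = ⊥-elim (m+n≮m m y m+y<m)
  ... | no _ = cong₂ _+_ (m+n∸m≡n m y) (m+n∸m≡n m y)

  rot<n : ∀ {x} → x < n → rot x < n
  rot<n x<n with cycleHalf x<n
  ... | lower x<m = subst (_< n) (sym (rot-lower x<m)) (s≤s (+-monoʳ-< m x<m))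
  ... | upper y y≤m = subst (_< n) (sym (rot-upper y)) (s≤s (≤-trans y≤m (m≤m+n m m)))

  rot-injective : ∀ {x x′} → x < n → x′ < n → rot x ≡ rot x′ → x ≡ x′
  rot-injective x<n x′<n eq with cycleHalf x<n | cycleHalf x′<n
  ... | lower x<m | lower x′<m = +-cancelˡ-≡ m _ _ (suc-injective (trans (sym (rot-lower x<m)) (trans eq (rot-lower x′<m))))
  ... | lower x<m | upper y y≤m = ⊥-elim (<⇒≢ (s≤s (≤-trans y≤m (m≤m+n m _))) (trans (sym (rot-upper y)) (trans (sym eq) (rot-lower x<m))))
  ... | upper y y≤m | lower x′<m = ⊥-elim (<⇒≢ (s≤s (≤-trans y≤m (m≤m+n m _))) (trans (sym (rot-upper y)) (trans eq (rot-lower x′<m))))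
  ... | upper y _ | upper y′ _ = cong (m +_) (trans (sym (rot-upper y)) (trans eq (rot-upper y′)))

  τ<n : ∀ {x} → x < n → τ x < n
  τ<n x<n with cycleHalf x<n
  ... | lower {x} x<m = subst (_< n) (sym (τ-lower x<m)) (s≤s (+-mono-< x<m x<m))
  ... | upper y y≤m = subst (_< n) (sym (τ-upper y)) (s≤s (+-mono-≤ y≤m y≤m))

  τ-injective : ∀ {x x′} → x < n → x′ < n → τ x ≡ τ x′ → x ≡ x′
  τ-injective x<n x′<n eq with cycleHalf x<n | cycleHalf x′<n
  ... | lower x<m | lower x′<m = double-injective (suc-injective (trans (sym (τ-lower x<m)) (trans eq (τ-lower x′<m))))
  ... | lower {x} x<m | upper y _ = ⊥-elim (odd≢even x y (trans (sym (τ-lower x<m)) (trans eq (τ-upper y))))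
  ... | upper y _ | lower {x′} x′<m = ⊥-elim (odd≢even x′ y (trans (sym (τ-lower x′<m)) (trans (sym eq) (τ-upper y))))
  ... | upper y _ | upper y′ _ = cong (m +_) (double-injective (trans (sym (τ-upper y)) (trans eq (τ-upper y′))))

  x+rot≡m+τ : ∀ {x} → x < n → x + rot x ≡ m + τ x
  x+rot≡m+τ x<n with cycleHalf x<n
  ... | lower {x} x<m rewrite rot-lower x<m | τ-lower x<m = lower-identity m x
    where
    lower-identity : ∀ m x → x + suc (m + x) ≡ m + suc (x + x)
    lower-identity = solve-∀
  ... | upper y _ rewrite rot-upper y | τ-upper y = +-assoc m y y

  cycleLabel : ℕ → ℕ
  cycleLabel zero = zero
  cycleLabel (suc zero) = suc m
  cycleLabel (suc (suc p)) = suc (cycleLabel p)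

  cycleLabel-even : ∀ u → cycleLabel (u + u) ≡ u
  cycleLabel-even zero = refl
  cycleLabel-even (suc u) rewrite +-suc u u = cong suc (cycleLabel-even u)

  cycleLabel-odd : ∀ u → cycleLabel (suc (u + u)) ≡ suc (m + u)
  cycleLabel-odd zero = cong suc (sym (+-identityʳ m))
  cycleLabel-odd (suc u) rewrite +-suc u u = trans (cong suc (cycleLabel-odd u)) (cong suc (sym (+-suc m u)))

  cycleLabel<n : ∀ {p} → p < n → cycleLabel p < n
  cycleLabel<n {p} p<n with parityView p | p<n
  ... | even u | u+u<n rewrite cycleLabel-even u = s≤s (≤-trans (double-cancel-≤ (≤-pred u+u<n)) (m≤m+n m m))
  ... | odd u | u+u<n rewrite cycleLabel-odd u = s≤s (+-monoʳ-< m (double-cancel-< (≤-pred u+u<n)))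

  cycleLabel-injective : ∀ {p p′} → p < n → p′ < n → cycleLabel p ≡ cycleLabel p′ → p ≡ p′
  cycleLabel-injective {p} {p′} p<n p′<n eq with parityView p | parityView p′ | p<n | p′<n
  ... | even u | even u′ | _ | _ = cong (λ w → w + w) (trans (sym (cycleLabel-even u)) (trans eq (cycleLabel-even u′)))
  ... | even u | odd u′ | u+u<n | _ = ⊥-elim (<⇒≢ (s≤s (≤-trans (double-cancel-≤ (≤-pred u+u<n)) (m≤m+n m u′)))
                                                   (trans (sym (cycleLabel-even u)) (trans eq (cycleLabel-odd u′))))
  ... | odd u | even u′ | _ | u′+u′<n = ⊥-elim (<⇒≢ (s≤s (≤-trans (double-cancel-≤ (≤-pred u′+u′<n)) (m≤m+n m u)))
                                                     (trans (sym (cycleLabel-even u′)) (trans (sym eq) (cycleLabel-odd u))))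
  ... | odd u | odd u′ | _ | _ = cong (λ w → suc (w + w)) (+-cancelˡ-≡ m u u′ (suc-injective (trans (sym (cycleLabel-odd u)) (trans eq (cycleLabel-odd u′)))))

  cycleLabel-step : ∀ {p} → suc p < n → cycleLabel (suc p) ≡ rot (cycleLabel p)
  cycleLabel-step {p} 1+p<n with parityView p | 1+p<n
  ... | even u | 1+u+u<n rewrite cycleLabel-even u = trans (cycleLabel-odd u) (sym (rot-lower (double-cancel-< (≤-pred 1+u+u<n))))
  ... | odd u | _ rewrite cycleLabel-even u | cycleLabel-odd u = sym (trans (cong rot (sym (+-suc m u))) (rot-upper (suc u)))

  cycleLabel-wrap : cycleLabel 0 ≡ rot (cycleLabel (m + m))
  cycleLabel-wrap rewrite cycleLabel-even m = sym (trans (cong rot (sym (+-identityʳ m))) (rot-upper 0))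

  -- A vertex is determined by the shifted label x of its cycle vertex: the cycle vertex itself, its pendant in
  -- layer t < k, or its extra pendant, which exists only at a_r (x = j) and at a_{n−r} (x = m + e + 1).
  data Code : Set where
    cycle   : ℕ → Code
    pendant : ℕ → ℕ → Code
    extra   : ℕ → Code

  Valid : Code → Set
  Valid (cycle x) = x < n
  Valid (pendant t x) = t < k × x < n
  Valid (extra x) = x ≡ j ⊎ x ≡ suc (m + e)

  anchor : Code → ℕ
  anchor (cycle x) = x
  anchor (pendant _ x) = x
  anchor (extra x) = x

  firstOffsets extraOffsets : ℕ → ℕ × ℕ
  firstOffsets x with x ≤? j | x <? m
  ... | yes _ | _ = suc (suc (m + x)) , suc x + suc x
  ... | no _ | yes _ = suc (suc (suc (suc (m + x)))) , suc (suc x) + suc (suc x)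
  ... | no _ | no _ = suc (x ∸ m) , suc ((x ∸ m) + (x ∸ m))
  extraOffsets x with x ≤? j
  ... | yes _ = suc (suc (suc (suc (m + x)))) , suc (suc x) + suc (suc x)
  ... | no _ = suc (suc (suc (m + j))) , suc (suc m + suc m)

  vertexOffset sumOffset : Code → ℕ
  vertexOffset (cycle x) = suc x
  vertexOffset (pendant zero x) = proj₁ (firstOffsets x)
  vertexOffset (pendant (suc _) x) = suc (rot x)
  vertexOffset (extra x) = proj₁ (extraOffsets x)
  sumOffset (cycle x) = suc (τ x)
  sumOffset (pendant zero x) = proj₂ (firstOffsets x)
  sumOffset (pendant (suc _) x) = suc (τ x)
  sumOffset (extra x) = proj₂ (extraOffsets x)

  -- Vertex labels are start (block c) + vertexOffset c and edge sums are m + 1 + start (block c) + sumOffset c,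
  -- both offsets lying in 1 … width (block c): block 0 is the cycle, 1 is layer 0 with the extras, t + 1 is layer t.
  width : ℕ → ℕ
  width zero = n
  width (suc zero) = suc (suc n)
  width (suc (suc _)) = n

  module Layers = ConsecutiveBlocks width

  block : Code → ℕ
  block (cycle _) = 0
  block (pendant zero _) = 1
  block (pendant (suc t) _) = suc (suc t)
  block (extra _) = 1

  vertexLabel : Code → ℕ
  vertexLabel c = Layers.start (block c) + vertexOffset c

  -- the edge sum of the edge charged to c: a cycle vertex is charged its edge to the next one
  codeSum : Code → ℕ
  codeSum (cycle x) = suc x + suc (rot x)
  codeSum c = suc (anchor c) + vertexLabel c

  L : ℕ
  L = n + (n * k + 2)

  -- Block 1 (layer 0 and the extra pendants) split into the five runs along which its vertex labels increase.
  data FirstLayer : ℕ → Code → Set where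
    high   : ∀ y → y ≤ m → FirstLayer 0 (pendant 0 (m + y))
    low    : ∀ u → u ≤ j → FirstLayer 1 (pendant 0 u)
    extraB : FirstLayer 2 (extra (suc (m + e)))
    extraA : FirstLayer 3 (extra j)
    mid    : ∀ u → u < e → FirstLayer 4 (pendant 0 (suc (j + u)))

  j<m : j < m
  j<m = s≤s (m≤m+n j e)

  firstLayer-pendant : ∀ {x} → x < n → ∃ λ π → FirstLayer π (pendant 0 x)
  firstLayer-pendant {x} x<n with x ≤? j | cycleHalf x<n
  ... | yes x≤j | _ = 1 , low x x≤j
  ... | no _ | upper y y≤m = 0 , high y y≤m
  ... | no x≰j | lower x<m with u , refl ← m≤n⇒∃[o]m+o≡n (≰⇒> x≰j) = 4 , mid u (+-cancelˡ-< (suc j) u e x<m)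

  firstLayer-extra : ∀ {x} → x ≡ j ⊎ x ≡ suc (m + e) → ∃ λ π → FirstLayer π (extra x)
  firstLayer-extra (inj₁ refl) = 3 , extraA
  firstLayer-extra (inj₂ refl) = 2 , extraB

  runWidth : ℕ → ℕ
  runWidth 0 = suc m
  runWidth 1 = suc j
  runWidth 2 = 1
  runWidth 3 = 1
  runWidth _ = e

  module Runs = ConsecutiveBlocks runWidth

  runOffset : ∀ {π c} → FirstLayer π c → ℕ
  runOffset (high y _) = suc y
  runOffset (low u _) = suc u
  runOffset extraB = 1
  runOffset extraA = 1
  runOffset (mid u _) = suc u

  runOffset-range : ∀ {π c} (v : FirstLayer π c) → Runs.Offset π (runOffset v)
  runOffset-range (high y y≤m) = s≤s z≤n , s≤s y≤m
  runOffset-range (low u u≤j) = s≤s z≤n , s≤s u≤j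
  runOffset-range extraB = ≤-refl , ≤-refl
  runOffset-range extraA = ≤-refl , ≤-refl
  runOffset-range (mid u u<e) = s≤s z≤n , u<e

  runOffset-injective : ∀ {π c c′} (v : FirstLayer π c) (v′ : FirstLayer π c′) → runOffset v ≡ runOffset v′ → c ≡ c′
  runOffset-injective (high y _) (high y′ _) eq = cong (λ w → pendant 0 (m + w)) (suc-injective eq)
  runOffset-injective (low u _) (low u′ _) eq = cong (pendant 0) (suc-injective eq)
  runOffset-injective extraB extraB _ = refl
  runOffset-injective extraA extraA _ = refl
  runOffset-injective (mid u _) (mid u′ _) eq = cong (λ w → pendant 0 (suc (j + w))) (suc-injective eq)

  run<5 : ∀ {π c} → FirstLayer π c → π < 5
  run<5 (high _ _) = s≤s z≤n
  run<5 (low _ _) = s≤s (s≤s z≤n)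
  run<5 extraB = s≤s (s≤s (s≤s z≤n))
  run<5 extraA = s≤s (s≤s (s≤s (s≤s z≤n)))
  run<5 (mid _ _) = ≤-refl

  Runs-start-end : Runs.start 5 ≡ suc (suc n)
  Runs-start-end = identity j e
    where
    identity : ∀ j e → suc (suc (j + e)) + suc j + 1 + 1 + e ≡ suc (suc (suc (suc (j + e) + suc (j + e))))
    identity = solve-∀

  sumOfRun : ∀ {π c} → FirstLayer π c → ℕ
  sumOfRun (high y _) = suc (y + y)
  sumOfRun (low u _) = suc u + suc u
  sumOfRun extraB = suc (suc m + suc m)
  sumOfRun extraA = suc (suc j) + suc (suc j)
  sumOfRun (mid u _) = suc (suc (suc (j + u))) + suc (suc (suc (j + u)))

  firstLayer-offsets : ∀ {π c} (v : FirstLayer π c) → vertexOffset c ≡ Runs.start π + runOffset v × sumOffset c ≡ sumOfRun v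
  firstLayer-offsets (high y y≤m) with m + y ≤? j | m + y <? m
  ... | yes m+y≤j | _ = ⊥-elim (<⇒≱ j<m (≤-trans (m≤m+n m y) m+y≤j))
  ... | no _ | yes m+y<m = ⊥-elim (m+n≮m m y m+y<m)
  ... | no _ | no _ = cong suc (m+n∸m≡n m y) , cong suc (cong₂ _+_ (m+n∸m≡n m y) (m+n∸m≡n m y))
  firstLayer-offsets (low u u≤j) with u ≤? j
  ... | yes _ = cong suc (sym (+-suc m u)) , refl
  ... | no u≰j = ⊥-elim (u≰j u≤j)
  firstLayer-offsets extraB with suc (m + e) ≤? j
  ... | yes m<j = ⊥-elim (<⇒≱ j<m (≤-trans (n≤1+n m) (≤-trans (s≤s (m≤m+n m e)) m<j)))
  ... | no _ = identity m j , refl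
    where
    identity : ∀ m j → suc (suc (suc (m + j))) ≡ suc m + suc j + 1
    identity = solve-∀
  firstLayer-offsets extraA with j ≤? j
  ... | yes _ = identity m j , refl
    where
    identity : ∀ m j → suc (suc (suc (suc (m + j)))) ≡ suc m + suc j + 1 + 1
    identity = solve-∀
  ... | no j≰j = ⊥-elim (j≰j ≤-refl)
  firstLayer-offsets (mid u u<e) with suc (j + u) ≤? j | suc (j + u) <? m
  ... | yes j<j+u | _ = ⊥-elim (<⇒≱ (s≤s (m≤m+n j u)) j<j+u)
  ... | no _ | yes _ = identity m j u , refl
    where
    identity : ∀ m j u → suc (suc (suc (suc (m + suc (j + u))))) ≡ suc m + suc j + 1 + 1 + suc u
    identity = solve-∀
  ... | no _ | no j+u≮m = ⊥-elim (j+u≮m (s≤s (+-monoʳ-< j u<e)))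

  2+2m≤2+n : suc m + suc m ≤ suc (suc n)
  2+2m≤2+n = ≤-trans (≤-reflexive (cong suc (+-suc m m))) (n≤1+n _)

  sumOfRun-range : ∀ {π c} (v : FirstLayer π c) → 1 ≤ sumOfRun v × sumOfRun v ≤ suc (suc n)
  sumOfRun-range (high y y≤m) = s≤s z≤n , s≤s (≤-trans (+-mono-≤ y≤m y≤m) (≤-trans (n≤1+n _) (n≤1+n _)))
  sumOfRun-range (low u u≤j) = s≤s z≤n , ≤-trans (+-mono-≤ u<m u<m) (m≤n+m (m + m) 3)
    where
    u<m = <-≤-trans (s≤s u≤j) j<m
  sumOfRun-range extraB = s≤s z≤n , ≤-reflexive (cong (λ w → suc (suc w)) (+-suc m m))
  sumOfRun-range extraA = s≤s z≤n , ≤-trans (+-mono-≤ (s≤s j<m) (s≤s j<m)) 2+2m≤2+n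
  sumOfRun-range (mid u u<e) = s≤s z≤n , ≤-trans (+-mono-≤ bound bound) 2+2m≤2+n
    where
    bound : suc (suc (suc (j + u))) ≤ suc m
    bound = s≤s (s≤s (subst (_≤ j + e) (+-suc j u) (+-monoʳ-≤ j u<e)))

  j≤1+j+u : ∀ u → j ≤ suc (j + u)
  j≤1+j+u u = ≤-trans (m≤m+n j u) (n≤1+n _)

  sumOfRun-injective : ∀ {π π′ c c′} (v : FirstLayer π c) (v′ : FirstLayer π′ c′) → sumOfRun v ≡ sumOfRun v′ → c ≡ c′
  sumOfRun-injective (high y _) (high y′ _) eq = cong (λ w → pendant 0 (m + w)) (double-injective (suc-injective eq))
  sumOfRun-injective (high y y≤m) extraB eq = ⊥-elim (<⇒≢ (s≤s y≤m) (double-injective (suc-injective eq)))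
  sumOfRun-injective extraB (high y y≤m) eq = ⊥-elim (<⇒≢ (s≤s y≤m) (double-injective (suc-injective (sym eq))))
  sumOfRun-injective extraB extraB _ = refl
  sumOfRun-injective (low u _) (low u′ _) eq = cong (pendant 0) (suc-injective (double-injective eq))
  sumOfRun-injective (low u u≤j) extraA eq = ⊥-elim (<⇒≢ (s≤s (s≤s u≤j)) (double-injective eq))
  sumOfRun-injective extraA (low u u≤j) eq = ⊥-elim (<⇒≢ (s≤s (s≤s u≤j)) (double-injective (sym eq)))
  sumOfRun-injective (low u u≤j) (mid u′ _) eq = ⊥-elim (<⇒≢ (s≤s (s≤s (≤-trans u≤j (j≤1+j+u u′)))) (double-injective eq))
  sumOfRun-injective (mid u′ _) (low u u≤j) eq = ⊥-elim (<⇒≢ (s≤s (s≤s (≤-trans u≤j (j≤1+j+u u′)))) (double-injective (sym eq)))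
  sumOfRun-injective extraA extraA _ = refl
  sumOfRun-injective extraA (mid u _) eq = ⊥-elim (<⇒≢ (s≤s (s≤s (s≤s (m≤m+n j u)))) (double-injective eq))
  sumOfRun-injective (mid u _) extraA eq = ⊥-elim (<⇒≢ (s≤s (s≤s (s≤s (m≤m+n j u)))) (double-injective (sym eq)))
  sumOfRun-injective (mid u _) (mid u′ _) eq =
    cong (λ w → pendant 0 (suc (j + w))) (+-cancelˡ-≡ j u u′ (suc-injective (suc-injective (suc-injective (double-injective eq)))))
  sumOfRun-injective (high y _) (low u _) eq = ⊥-elim (odd≢even y (suc u) eq)
  sumOfRun-injective (high y _) extraA eq = ⊥-elim (odd≢even y (suc (suc j)) eq)
  sumOfRun-injective (high y _) (mid u _) eq = ⊥-elim (odd≢even y (suc (suc (suc (j + u)))) eq)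
  sumOfRun-injective extraB (low u _) eq = ⊥-elim (odd≢even (suc m) (suc u) eq)
  sumOfRun-injective extraB extraA eq = ⊥-elim (odd≢even (suc m) (suc (suc j)) eq)
  sumOfRun-injective extraB (mid u _) eq = ⊥-elim (odd≢even (suc m) (suc (suc (suc (j + u)))) eq)
  sumOfRun-injective (low u _) (high y _) eq = ⊥-elim (odd≢even y (suc u) (sym eq))
  sumOfRun-injective extraA (high y _) eq = ⊥-elim (odd≢even y (suc (suc j)) (sym eq))
  sumOfRun-injective (mid u _) (high y _) eq = ⊥-elim (odd≢even y (suc (suc (suc (j + u)))) (sym eq))
  sumOfRun-injective (low u _) extraB eq = ⊥-elim (odd≢even (suc m) (suc u) (sym eq))
  sumOfRun-injective extraA extraB eq = ⊥-elim (odd≢even (suc m) (suc (suc j)) (sym eq))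
  sumOfRun-injective (mid u _) extraB eq = ⊥-elim (odd≢even (suc m) (suc (suc (suc (j + u)))) (sym eq))

  run-balance : ∀ {π c} (v : FirstLayer π c) → anchor c + (Runs.start π + runOffset v) ≡ m + sumOfRun v
  run-balance (high y _) = identity m y
    where
    identity : ∀ m y → m + y + suc y ≡ m + suc (y + y)
    identity = solve-∀
  run-balance (low u _) = identity m u
    where
    identity : ∀ m u → u + (suc m + suc u) ≡ m + (suc u + suc u)
    identity = solve-∀
  run-balance extraB = identity j e
    where
    identity : ∀ j e → let m = suc (j + e) in suc (m + e) + (suc m + suc j + 1) ≡ m + suc (suc m + suc m)
    identity = solve-∀
  run-balance extraA = identity m j
    where
    identity : ∀ m j → j + (suc m + suc j + 1 + 1) ≡ m + (suc (suc j) + suc (suc j))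
    identity = solve-∀
  run-balance (mid u _) = identity m j u
    where
    identity : ∀ m j u → suc (j + u) + (suc m + suc j + 1 + 1 + suc u) ≡ m + (suc (suc (suc (j + u))) + suc (suc (suc (j + u))))
    identity = solve-∀

  Layers-start-end : Layers.start (suc k) ≡ L
  Layers-start-end = trans (start-layer k′) (cong (λ w → n + (w + 2)) (*-comm k n))
    where
    start-layer : ∀ t → Layers.start (suc (suc t)) ≡ n + (suc t * n + 2)
    start-layer zero = identity n
      where
      identity : ∀ n → n + suc (suc n) ≡ n + ((n + 0) + 2)
      identity = solve-∀
    start-layer (suc t) = trans (cong (_+ n) (start-layer t)) (identity n t)
      where
      identity : ∀ n t → n + (suc t * n + 2) + n ≡ n + (suc (suc t) * n + 2)
      identity = solve-∀

  block<1+k : ∀ {c} → Valid c → block c < suc k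
  block<1+k {cycle _} _ = s≤s z≤n
  block<1+k {pendant zero _} _ = s≤s (s≤s z≤n)
  block<1+k {pendant (suc t) _} (t<k , _) = s≤s t<k
  block<1+k {extra _} _ = s≤s (s≤s z≤n)

  firstLayer : ∀ {c} → Valid c → block c ≡ 1 → ∃ λ π → FirstLayer π c
  firstLayer {pendant zero x} (_ , x<n) _ = firstLayer-pendant x<n
  firstLayer {extra x} x∈ _ = firstLayer-extra x∈

  firstLayer-vertexOffset-range : ∀ {π c} (v : FirstLayer π c) → Layers.Offset 1 (vertexOffset c)
  firstLayer-vertexOffset-range v rewrite proj₁ (firstLayer-offsets v) | sym Runs-start-end = Runs.start+offset-range (run<5 v) (runOffset-range v)

  vertexOffset-range : ∀ {c} → Valid c → Layers.Offset (block c) (vertexOffset c)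
  vertexOffset-range {cycle x} x<n = s≤s z≤n , x<n
  vertexOffset-range {pendant (suc t) x} (_ , x<n) = s≤s z≤n , rot<n x<n
  vertexOffset-range {pendant zero x} vc = firstLayer-vertexOffset-range (proj₂ (firstLayer vc refl))
  vertexOffset-range {extra x} vc = firstLayer-vertexOffset-range (proj₂ (firstLayer vc refl))

  sumOffset-range : ∀ {c} → Valid c → Layers.Offset (block c) (sumOffset c)
  sumOffset-range {cycle x} x<n = s≤s z≤n , τ<n x<n
  sumOffset-range {pendant (suc t) x} (_ , x<n) = s≤s z≤n , τ<n x<n
  sumOffset-range {pendant zero x} vc with _ , v ← firstLayer vc refl rewrite proj₂ (firstLayer-offsets v) = sumOfRun-range v
  sumOffset-range {extra x} vc with _ , v ← firstLayer vc refl rewrite proj₂ (firstLayer-offsets v) = sumOfRun-range v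

  private
    balance-shift : ∀ x v m s S → x + v ≡ m + s → suc x + (S + v) ≡ suc m + (S + s)
    balance-shift x v m s S eq = begin
      suc x + (S + v)   ≡⟨ cong suc (x∙yz≈y∙xz x S v) ⟩
      suc (S + (x + v)) ≡⟨ cong (λ w → suc (S + w)) eq ⟩
      suc (S + (m + s)) ≡⟨ cong suc (x∙yz≈y∙xz S m s) ⟩
      suc m + (S + s)   ∎
      where open ≡-Reasoning

    x+1+rot≡m+1+τ : ∀ {x} → x < n → x + suc (rot x) ≡ m + suc (τ x)
    x+1+rot≡m+1+τ {x} x<n = trans (+-suc x (rot x)) (trans (cong suc (x+rot≡m+τ x<n)) (sym (+-suc m (τ x))))

  firstLayer-balance : ∀ {π c} (v : FirstLayer π c) → anchor c + vertexOffset c ≡ m + sumOffset c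
  firstLayer-balance v rewrite proj₁ (firstLayer-offsets v) | proj₂ (firstLayer-offsets v) = run-balance v

  codeSum≡ : ∀ {c} → Valid c → codeSum c ≡ suc m + (Layers.start (block c) + sumOffset c)
  codeSum≡ {cycle x} x<n = balance-shift x _ m _ 0 (x+1+rot≡m+1+τ x<n)
  codeSum≡ {pendant (suc t) x} (_ , x<n) = balance-shift x _ m _ (Layers.start (suc (suc t))) (x+1+rot≡m+1+τ x<n)
  codeSum≡ {pendant zero x} vc = balance-shift x _ m _ n (firstLayer-balance (proj₂ (firstLayer vc refl)))
  codeSum≡ {extra x} vc = balance-shift x _ m _ n (firstLayer-balance (proj₂ (firstLayer vc refl)))

  sameBlock-injective : (f : Code → ℕ) →
    (∀ {x x′} → x < n → x′ < n → f (cycle x) ≡ f (cycle x′) → x ≡ x′) →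
    (∀ {t x x′} → x < n → x′ < n → f (pendant (suc t) x) ≡ f (pendant (suc t) x′) → x ≡ x′) →
    (∀ {π π′ c c′} → FirstLayer π c → FirstLayer π′ c′ → f c ≡ f c′ → c ≡ c′) →
    ∀ {c c′} → Valid c → Valid c′ → block c ≡ block c′ → f c ≡ f c′ → c ≡ c′
  sameBlock-injective f onCycle onLayer onFirst = go
    where
    first : ∀ {c c′} → Valid c → Valid c′ → block c ≡ 1 → block c′ ≡ 1 → f c ≡ f c′ → c ≡ c′
    first vc vc′ b≡1 b′≡1 = onFirst (proj₂ (firstLayer vc b≡1)) (proj₂ (firstLayer vc′ b′≡1))
    go : ∀ {c c′} → Valid c → Valid c′ → block c ≡ block c′ → f c ≡ f c′ → c ≡ c′
    go {cycle x} {cycle x′} vc vc′ refl eq = cong cycle (onCycle vc vc′ eq)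
    go {pendant (suc t) x} {pendant (suc t′) x′} (_ , x<n) (_ , x′<n) refl eq = cong (pendant (suc t)) (onLayer x<n x′<n eq)
    go {pendant zero x} {pendant zero x′} vc vc′ _ = first vc vc′ refl refl
    go {pendant zero x} {extra x′} vc vc′ _ = first vc vc′ refl refl
    go {extra x} {pendant zero x′} vc vc′ _ = first vc vc′ refl refl
    go {extra x} {extra x′} vc vc′ _ = first vc vc′ refl refl
    go {cycle _} {pendant zero _} _ _ ()
    go {cycle _} {pendant (suc _) _} _ _ ()
    go {cycle _} {extra _} _ _ ()
    go {pendant zero _} {cycle _} _ _ ()
    go {pendant zero _} {pendant (suc _) _} _ _ ()
    go {pendant (suc _) _} {cycle _} _ _ ()
    go {pendant (suc _) _} {pendant zero _} _ _ ()
    go {pendant (suc _) _} {extra _} _ _ ()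
    go {extra _} {cycle _} _ _ ()
    go {extra _} {pendant (suc _) _} _ _ ()

  vertexLabel-injective : ∀ {c c′} → Valid c → Valid c′ → vertexLabel c ≡ vertexLabel c′ → c ≡ c′
  vertexLabel-injective vc vc′ eq with Layers.start+offset-injective (vertexOffset-range vc) (vertexOffset-range vc′) eq
  ... | block≡ , offset≡ =
    sameBlock-injective vertexOffset (λ _ _ → suc-injective) (λ x<n x′<n → rot-injective x<n x′<n ∘ suc-injective) onFirst vc vc′ block≡ offset≡
    where
    onFirst : ∀ {π π′ c c′} → FirstLayer π c → FirstLayer π′ c′ → vertexOffset c ≡ vertexOffset c′ → c ≡ c′
    onFirst v v′ eq rewrite proj₁ (firstLayer-offsets v) | proj₁ (firstLayer-offsets v′)
      with Runs.start+offset-injective (runOffset-range v) (runOffset-range v′) eq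
    ... | refl , run≡ = runOffset-injective v v′ run≡

  codeSum-injective : ∀ {c c′} → Valid c → Valid c′ → codeSum c ≡ codeSum c′ → c ≡ c′
  codeSum-injective {c} {c′} vc vc′ eq
    with Layers.start+offset-injective (sumOffset-range vc) (sumOffset-range vc′) (+-cancelˡ-≡ (suc m) _ _ (trans (sym (codeSum≡ vc)) (trans eq (codeSum≡ vc′))))
  ... | block≡ , offset≡ = sameBlock-injective sumOffset onAnchor onAnchor onFirst vc vc′ block≡ offset≡
    where
    onFirst : ∀ {π π′ c c′} → FirstLayer π c → FirstLayer π′ c′ → sumOffset c ≡ sumOffset c′ → c ≡ c′
    onFirst v v′ eq rewrite proj₂ (firstLayer-offsets v) | proj₂ (firstLayer-offsets v′) = sumOfRun-injective v v′ eq
    onAnchor : ∀ {x x′} → x < n → x′ < n → suc (τ x) ≡ suc (τ x′) → x ≡ x′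
    onAnchor x<n x′<n = τ-injective x<n x′<n ∘ suc-injective

  vertexLabel-range : ∀ {c} → Valid c → InRange L (vertexLabel c)
  vertexLabel-range vc rewrite sym Layers-start-end = Layers.start+offset-range (block<1+k vc) (vertexOffset-range vc)

  codeSum-range : ∀ {c} → Valid c → codeSum c ≤ suc m + L × suc m + L < codeSum c + L
  codeSum-range {c} vc = subst (_≤ suc m + L) (sym (codeSum≡ vc)) (+-monoʳ-≤ (suc m) X≤L)
                        , subst (λ s → suc m + L < s + L) (sym (codeSum≡ vc)) (+-monoˡ-< L (m<m+n (suc m) 1≤X))
    where
    X = Layers.start (block c) + sumOffset c
    bounds : 1 ≤ X × X ≤ L
    bounds = subst (λ B → 1 ≤ X × X ≤ B) Layers-start-end (Layers.start+offset-range (block<1+k vc) (sumOffset-range vc))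
    1≤X = proj₁ bounds
    X≤L = proj₂ bounds

module Labelling (j e k′ : ℕ) where
  open Construction j e k′

  r : ℕ
  r = suc (j + j)

  G : Graph
  G = GraphNKR n k r

  Pendant : Set
  Pendant = Σ (Fin n) (λ i → Fin (pendants n k r i))

  Special : ℕ → Set
  Special p = p ≡ j + j ⊎ p ≡ suc (e + e)

  n∸r : n ∸ r ≡ suc (suc (e + e))
  n∸r = trans (cong (_∸ (j + j)) (identity j e)) (m+n∸m≡n (j + j) _)
    where
    identity : ∀ j e → suc (j + e) + suc (j + e) ≡ (j + j) + suc (suc (e + e))
    identity = solve-∀

  pendants-at-special : ∀ {i} → Special (toℕ i) → pendants n k r i ≡ suc k
  pendants-at-special {i} (inj₁ i≡) = pendants-special n k r i (inj₁ (cong suc i≡))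
  pendants-at-special {i} (inj₂ i≡) = pendants-special n k r i (inj₂ (trans (cong suc i≡) (sym n∸r)))

  pendants-at-ordinary : ∀ {i} → ¬ Special (toℕ i) → pendants n k r i ≡ k
  pendants-at-ordinary {i} ¬special =
    pendants-ordinary n k r i (¬special ∘ inj₁ ∘ suc-injective) (¬special ∘ inj₂ ∘ suc-injective ∘ (λ eq → trans eq n∸r))

  special? : ∀ p → Dec (Special p)
  special? p with p ≟ j + j | p ≟ suc (e + e)
  ... | yes p≡ | _ = yes (inj₁ p≡)
  ... | no _ | yes p≡ = yes (inj₂ p≡)
  ... | no p≢ | no p≢′ = no [ p≢ , p≢′ ]

  k≤pendants : ∀ i → k ≤ pendants n k r i
  k≤pendants i with special? (toℕ i)
  ... | yes special = ≤-trans (n≤1+n k) (≤-reflexive (sym (pendants-at-special special)))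
  ... | no ordinary = ≤-reflexive (sym (pendants-at-ordinary ordinary))

  extra-at-special : ∀ {i} (s : Fin (pendants n k r i)) → ¬ toℕ s < k → Special (toℕ i) × toℕ s ≡ k
  extra-at-special {i} s s≮k with special? (toℕ i)
  ... | yes special = special , ≤-antisym (≤-pred (subst (toℕ s <_) (pendants-at-special special) (toℕ<n s))) (≮⇒≥ s≮k)
  ... | no ordinary = ⊥-elim (s≮k (subst (toℕ s <_) (pendants-at-ordinary ordinary) (toℕ<n s)))

  anchorLabel : Fin n → ℕ
  anchorLabel i = cycleLabel (toℕ i)

  pendantCode : ∀ {i} (s : Fin (pendants n k r i)) → Dec (toℕ s < k) → Code
  pendantCode {i} s (yes _) = pendant (toℕ s) (anchorLabel i)
  pendantCode {i} s (no _) = extra (anchorLabel i)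

  code : V G → Code
  code (inj₁ i) = cycle (anchorLabel i)
  code (inj₂ (i , s)) = pendantCode s (toℕ s <? k)

  anchorLabel<n : ∀ i → anchorLabel i < n
  anchorLabel<n i = cycleLabel<n (toℕ<n i)

  anchorLabel-injective : ∀ {i i′} → anchorLabel i ≡ anchorLabel i′ → i ≡ i′
  anchorLabel-injective eq = toℕ-injective (cycleLabel-injective (toℕ<n _) (toℕ<n _) eq)

  anchorLabel-special : ∀ {i} → Special (toℕ i) → anchorLabel i ≡ j ⊎ anchorLabel i ≡ suc (m + e)
  anchorLabel-special {i} (inj₁ i≡) = inj₁ (trans (cong cycleLabel i≡) (cycleLabel-even j))
  anchorLabel-special {i} (inj₂ i≡) = inj₂ (trans (cong cycleLabel i≡) (cycleLabel-odd e))

  code-valid : ∀ v → Valid (code v)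
  code-valid (inj₁ i) = anchorLabel<n i
  code-valid (inj₂ (i , s)) with toℕ s <? k
  ... | yes s<k = s<k , anchorLabel<n i
  ... | no s≮k = anchorLabel-special (proj₁ (extra-at-special s s≮k))

  pendant-≡ : ∀ {i i′ : Fin n} {s : Fin (pendants n k r i)} {s′ : Fin (pendants n k r i′)} →
              i ≡ i′ → toℕ s ≡ toℕ s′ → _≡_ {A = Pendant} (i , s) (i′ , s′)
  pendant-≡ refl s≡ = cong (_ ,_) (toℕ-injective s≡)

  code-injective : ∀ {v v′} → code v ≡ code v′ → v ≡ v′
  code-injective {inj₁ i} {inj₁ i′} eq = cong inj₁ (anchorLabel-injective (cong anchor eq))
  code-injective {inj₁ i} {inj₂ (i′ , s′)} eq with toℕ s′ <? k
  ... | yes _ = contradiction eq λ ()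
  ... | no _ = contradiction eq λ ()
  code-injective {inj₂ (i , s)} {inj₁ i′} eq with toℕ s <? k
  ... | yes _ = contradiction eq λ ()
  ... | no _ = contradiction eq λ ()
  code-injective {inj₂ (i , s)} {inj₂ (i′ , s′)} eq with toℕ s <? k | toℕ s′ <? k
  ... | yes _ | yes _ = cong inj₂ (pendant-≡ (anchorLabel-injective (proj₂ (pendant-injective eq))) (proj₁ (pendant-injective eq)))
    where
    pendant-injective : ∀ {t t′ x x′} → pendant t x ≡ pendant t′ x′ → t ≡ t′ × x ≡ x′
    pendant-injective refl = refl , refl
  ... | yes _ | no _ = contradiction eq λ ()
  ... | no _ | yes _ = contradiction eq λ ()
  ... | no s≮k | no s′≮k = cong inj₂ (pendant-≡ (anchorLabel-injective (cong anchor eq))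
                                                (trans (proj₂ (extra-at-special s s≮k)) (sym (proj₂ (extra-at-special s′ s′≮k)))))

  anchorLabel-next : ∀ i → anchorLabel (next i) ≡ rot (anchorLabel i)
  anchorLabel-next i with toℕ-next i
  ... | inj₁ (1+i<n , next≡) rewrite next≡ = cycleLabel-step 1+i<n
  ... | inj₂ (i≡2m , next≡) rewrite next≡ | i≡2m = cycleLabel-wrap

  ℓ : V G → ℕ
  ℓ = vertexLabel ∘ code

  edgeSum≡codeSum : ∀ v → ℓ (proj₁ (ends G v)) + ℓ (proj₂ (ends G v)) ≡ codeSum (code v)
  edgeSum≡codeSum (inj₁ i) = cong (λ x → suc (anchorLabel i) + suc x) (anchorLabel-next i)
  edgeSum≡codeSum (inj₂ (i , s)) with toℕ s <? k
  ... | yes _ = refl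
  ... | no _ = refl

  private
    2j<n : j + j < n
    2j<n = s≤s (+-mono-≤ j≤m j≤m)
      where
      j≤m : j ≤ m
      j≤m = ≤-trans (m≤m+n j e) (n≤1+n _)

    1+2e<n : suc (e + e) < n
    1+2e<n = s≤s (+-mono-< e<m e<m)
      where
      e<m : e < m
      e<m = s≤s (m≤n+m e j)

    iA iB : Fin n
    iA = fromℕ< 2j<n
    iB = fromℕ< 1+2e<n

    iA-special : Special (toℕ iA)
    iA-special = inj₁ (toℕ-fromℕ< 2j<n)

    iB-special : Special (toℕ iB)
    iB-special = inj₂ (toℕ-fromℕ< 1+2e<n)

    k<pendants : ∀ {i} → Special (toℕ i) → k < pendants n k r i
    k<pendants special = ≤-reflexive (sym (pendants-at-special special))

    whichSpecial : ∀ {p} → Dec (p ≡ j + j) → Fin 2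
    whichSpecial (yes _) = fzero
    whichSpecial (no _) = fsuc fzero

    classify : (i : Fin n) (s : Fin (pendants n k r i)) → Dec (toℕ s < k) → (Fin n × Fin k) ⊎ Fin 2
    classify i s (yes s<k) = inj₁ (i , fromℕ< s<k)
    classify i s (no _) = inj₂ (whichSpecial (toℕ i ≟ j + j))

    toIndex : Pendant → (Fin n × Fin k) ⊎ Fin 2
    toIndex (i , s) = classify i s (toℕ s <? k)

    fromIndex : (Fin n × Fin k) ⊎ Fin 2 → Pendant
    fromIndex (inj₁ (i , t)) = i , inject≤ t (k≤pendants i)
    fromIndex (inj₂ fzero) = iA , fromℕ< (k<pendants iA-special)
    fromIndex (inj₂ (fsuc fzero)) = iB , fromℕ< (k<pendants iB-special)

    fromIndex-toIndex : ∀ p → fromIndex (toIndex p) ≡ p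
    fromIndex-toIndex (i , s) with toℕ s <? k
    ... | yes s<k = pendant-≡ refl (trans (toℕ-inject≤ _ _) (toℕ-fromℕ< s<k))
    ... | no s≮k with toℕ i ≟ j + j | extra-at-special s s≮k
    ...   | yes i≡ | _ , s≡k = pendant-≡ (toℕ-injective (trans (toℕ-fromℕ< 2j<n) (sym i≡))) (trans (toℕ-fromℕ< _) (sym s≡k))
    ...   | no i≢ | inj₁ i≡ , _ = ⊥-elim (i≢ i≡)
    ...   | no _ | inj₂ i≡ , s≡k = pendant-≡ (toℕ-injective (trans (toℕ-fromℕ< 1+2e<n) (sym i≡))) (trans (toℕ-fromℕ< _) (sym s≡k))

    toIndex-fromIndex : ∀ w → toIndex (fromIndex w) ≡ w
    toIndex-fromIndex (inj₁ (i , t)) with toℕ (inject≤ t (k≤pendants i)) <? k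
    ... | yes t<k = cong (λ t′ → inj₁ (i , t′)) (toℕ-injective (trans (toℕ-fromℕ< t<k) (toℕ-inject≤ t _)))
    ... | no t≮k = ⊥-elim (t≮k (subst (_< k) (sym (toℕ-inject≤ t _)) (toℕ<n t)))
    toIndex-fromIndex (inj₂ fzero) with toℕ (fromℕ< (k<pendants iA-special)) <? k
    ... | yes k<k = ⊥-elim (<-irrefl (toℕ-fromℕ< _) k<k)
    ... | no _ with toℕ iA ≟ j + j
    ...   | yes _ = refl
    ...   | no iA≢ = ⊥-elim (iA≢ (toℕ-fromℕ< 2j<n))
    toIndex-fromIndex (inj₂ (fsuc fzero)) with toℕ (fromℕ< (k<pendants iB-special)) <? k
    ... | yes k<k = ⊥-elim (<-irrefl (toℕ-fromℕ< _) k<k)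
    ... | no _ with toℕ iB ≟ j + j
    ...   | yes iB≡ = ⊥-elim (odd≢even e j (trans (sym (toℕ-fromℕ< 1+2e<n)) iB≡))
    ...   | no _ = refl

  Pendant↔ : Pendant ↔ ((Fin n × Fin k) ⊎ Fin 2)
  Pendant↔ = mk↔ₛ′ toIndex fromIndex toIndex-fromIndex fromIndex-toIndex

  V↔ : V G ↔ Fin L
  V↔ = ↔-trans (↔-refl ⊎-↔ ↔-trans Pendant↔ (↔-sym *↔× ⊎-↔ ↔-refl)) (↔-trans (↔-refl ⊎-↔ ↔-sym +↔⊎) (↔-sym +↔⊎))

  other : V G → V G
  other (inj₁ i) = inj₁ (next i)
  other (inj₂ (i , _)) = inj₁ i

  ends≡ : ∀ v → ends G v ≡ (v , other v) ⊎ ends G v ≡ (other v , v)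
  ends≡ (inj₁ _) = inj₁ refl
  ends≡ (inj₂ _) = inj₂ refl

  Index : Set
  Index = Fin n ⊎ ((Fin n × Fin k) ⊎ Fin 2)

  vertexAt : Index → V G
  vertexAt (inj₁ i) = inj₁ i
  vertexAt (inj₂ w) = inj₂ (Inverse.from Pendant↔ w)

  vertexAt-injective : Injective _≡_ _≡_ vertexAt
  vertexAt-injective {inj₁ i} {inj₁ i′} refl = refl
  vertexAt-injective {inj₂ w} {inj₂ w′} eq = cong inj₂ (begin
    w                                           ≡⟨ sym (strictlyInverseˡ w) ⟩
    to (from w)                                 ≡⟨ cong to (inj₂-injective eq) ⟩
    to (from w′)                                ≡⟨ strictlyInverseˡ w′ ⟩
    w′                                          ∎)
    where
    open Inverse Pendant↔ using (to; from; strictlyInverseˡ)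
    open ≡-Reasoning

  pendantIndices : List (Fin n × Fin k)
  pendantIndices = cartesianProduct (allFin n) (allFin k)

  indices : List Index
  indices = map inj₁ (allFin n) ++ map inj₂ (map inj₁ pendantIndices ++ map inj₂ (allFin 2))

  private
    disjoint : ∀ {A B : Set} (xs : List A) (ys : List B) {z} → ¬ (z ∈ map inj₁ xs × z ∈ map inj₂ ys)
    disjoint xs ys (∈₁ , ∈₂) with ∈-map⁻ inj₁ ∈₁ | ∈-map⁻ inj₂ ∈₂
    ... | _ , _ , refl | _ , _ , ()

  indices-unique : Unique indices
  indices-unique = Unique.++⁺ (Unique.map⁺ inj₁-injective (Unique.allFin⁺ n))
    (Unique.map⁺ inj₂-injective (Unique.++⁺ (Unique.map⁺ inj₁-injective (Unique.cartesianProduct⁺ (Unique.allFin⁺ n) (Unique.allFin⁺ k)))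
                                            (Unique.map⁺ inj₂-injective (Unique.allFin⁺ 2)) (disjoint pendantIndices (allFin 2))))
    (disjoint (allFin n) _)

  length-indices : length indices ≡ L
  length-indices = begin
    length indices
      ≡⟨ length-map-++ inj₁ inj₂ (allFin n) _ ⟩
    length (allFin n) + length (map inj₁ pendantIndices ++ map inj₂ (allFin 2))
      ≡⟨ cong (length (allFin n) +_) (length-map-++ inj₁ inj₂ pendantIndices (allFin 2)) ⟩
    length (allFin n) + (length pendantIndices + length (allFin 2))
      ≡⟨ cong (λ l → length (allFin n) + (l + length (allFin 2))) (length-cartesianProduct (allFin n) (allFin k)) ⟩
    length (allFin n) + (length (allFin n) * length (allFin k) + length (allFin 2))
      ≡⟨ cong₂ (λ a b → a + (a * b + 2)) (length-allFin n) (length-allFin k) ⟩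
    L ∎
    where open ≡-Reasoning

  labeling : SEMTLabeling G (suc (L + (suc m + L)))
  labeling = semt-from-consecutive-sums G V↔ V↔ ℓ (λ v → vertexLabel-range (code-valid v))
    (λ {v} {v′} eq → code-injective (vertexLabel-injective (code-valid v) (code-valid v′) eq))
    (suc m + L) (λ v → subst (λ σ → σ ≤ suc m + L × suc m + L < σ + L) (sym (edgeSum≡codeSum v)) (codeSum-range (code-valid v)))
    (λ {v} {v′} eq → code-injective (codeSum-injective (code-valid v) (code-valid v′) (trans (sym (edgeSum≡codeSum v)) (trans eq (edgeSum≡codeSum v′)))))

  module _ {c} (lab : SEMTLabeling G c) where
    open SEMTLabeling lab

    private
      cycleVertexLabel : Fin n → ℕ
      cycleVertexLabel i = label (inj₁ (inj₁ i))

      cycle-bound : ∀ (h : Fin n → Fin n) → Injective _≡_ _≡_ h → n * suc n ≤ 2 * sumMap (cycleVertexLabel ∘ h) (allFin n)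
      cycle-bound h h-injective = distinct-sum-bound-Fin (cycleVertexLabel ∘ h) (h-injective ∘ inj₁-injective ∘ inj₁-injective ∘ label-injective lab)
        (λ i → label-range lab _)

    other-sum-bound : n * suc n + k * (n * suc n) ≤ 2 * sumMap (label ∘ inj₁ ∘ other) (map vertexAt indices)
    other-sum-bound = begin
      n * suc n + k * (n * suc n)
        ≤⟨ +-mono-≤ (cycle-bound next next-injective) (*-monoʳ-≤ k (cycle-bound (λ i → i) (λ eq → eq))) ⟩
      2 * Σnext + k * (2 * Σcycle)
        ≡⟨ cong (2 * Σnext +_) (*-left-comm k 2 Σcycle) ⟩
      2 * Σnext + 2 * (k * Σcycle)
        ≡⟨ sym (*-distribˡ-+ 2 Σnext _) ⟩
      2 * (Σnext + k * Σcycle)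
        ≤⟨ *-monoʳ-≤ 2 (+-monoʳ-≤ Σnext (m≤m+n _ Σextra)) ⟩
      2 * (Σnext + (k * Σcycle + Σextra))
        ≡⟨ cong (λ s → 2 * (Σnext + (s + Σextra))) (sym Σpendants) ⟩
      2 * (Σnext + (sumMap (O ∘ vertexAt ∘ inj₂ ∘ inj₁) pendantIndices + Σextra))
        ≡⟨ cong (λ s → 2 * (Σnext + s)) (sym (sumMap-map-++ (O ∘ vertexAt ∘ inj₂) inj₁ inj₂ pendantIndices (allFin 2))) ⟩
      2 * (Σnext + sumMap (O ∘ vertexAt ∘ inj₂) (map inj₁ pendantIndices ++ map inj₂ (allFin 2)))
        ≡⟨ cong (2 *_) (sym (sumMap-map-++ (O ∘ vertexAt) inj₁ inj₂ (allFin n) _)) ⟩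
      2 * sumMap (O ∘ vertexAt) indices
        ≡⟨ cong (2 *_) (sym (sumMap-map O vertexAt indices)) ⟩
      2 * sumMap O (map vertexAt indices) ∎
      where
      open ≤-Reasoning
      O = label ∘ inj₁ ∘ other
      Σnext = sumMap (cycleVertexLabel ∘ next) (allFin n)
      Σcycle = sumMap cycleVertexLabel (allFin n)
      Σextra = sumMap (O ∘ vertexAt ∘ inj₂ ∘ inj₂) (allFin 2)
      Σpendants : sumMap (O ∘ vertexAt ∘ inj₂ ∘ inj₁) pendantIndices ≡ k * Σcycle
      Σpendants = trans (sumMap-cartesianProduct cycleVertexLabel (allFin n) (allFin k)) (cong (_* Σcycle) (length-allFin k))

    -- L c ≥ L (2L + 1) + (k + 1) n (n + 1) / 2, which exceeds L (2L + m + 1) by 2mk + k + 1.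
    magic-constant-bound : suc (L + (suc m + L)) ≤ c
    magic-constant-bound = *-cancelˡ-< (2 * L) (L + (suc m + L)) c (begin-strict
      2 * L * (L + (suc m + L))
        <⟨ slack m k′ ⟩
      2 * (L * suc (2 * L)) + (n * suc n + k * (n * suc n))
        ≤⟨ +-monoʳ-≤ (2 * (L * suc (2 * L))) other-sum-bound ⟩
      2 * (L * suc (2 * L)) + 2 * Σother
        ≡⟨ sym (*-distribˡ-+ 2 (L * suc (2 * L)) Σother) ⟩
      2 * (L * suc (2 * L) + Σother)
        ≤⟨ *-monoʳ-≤ 2 (subst (λ N → N * suc (2 * N) + Σother ≤ N * c) length-es
                              (magic-lower-bound lab (λ v → v) other (λ eq → eq) ends≡ es (Unique.map⁺ vertexAt-injective indices-unique))) ⟩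
      2 * (L * c)
        ≡⟨ sym (*-assoc 2 L c) ⟩
      2 * L * c ∎)
      where
      open ≤-Reasoning
      es = map vertexAt indices
      Σother = sumMap (label ∘ inj₁ ∘ other) es
      length-es : length es ≡ L
      length-es = trans (length-map vertexAt indices) length-indices
      slack : ∀ m k′ → let n = suc (m + m); k = suc k′; L = n + (n * k + 2) in
              2 * L * (L + (suc m + L)) < 2 * (L * suc (2 * L)) + (n * suc n + k * (n * suc n))
      slack m k′ = subst (lhs <_) (identity m k′) (m<m+n lhs (s≤s z≤n))
        where
        lhs = let n = suc (m + m); L = n + (n * suc k′ + 2) in 2 * L * (L + (suc m + L))
        identity : ∀ m k′ → let n = suc (m + m); k = suc k′; L = n + (n * k + 2) in
                   2 * L * (L + (suc m + L)) + 2 * suc (2 * m * k + k) ≡ 2 * (L * suc (2 * L)) + (n * suc n + k * (n * suc n))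
        identity = solve-∀

  magic-strength : 2 * n * (k + 1) + 4 + (n + 3) / 2 ≡ suc (L + (suc m + L))
  magic-strength = begin
    2 * n * (k + 1) + 4 + (n + 3) / 2   ≡⟨ cong (λ h → 2 * n * (k + 1) + 4 + h / 2) (n+3≡[m+2]*2 m) ⟩
    2 * n * (k + 1) + 4 + (m + 2) * 2 / 2 ≡⟨ cong (2 * n * (k + 1) + 4 +_) (m*n/n≡m (m + 2) 2) ⟩
    2 * n * (k + 1) + 4 + (m + 2)       ≡⟨ identity m k′ ⟩
    suc (L + (suc m + L))               ∎
    where
    open ≡-Reasoning
    n+3≡[m+2]*2 : ∀ m → suc (m + m) + 3 ≡ (m + 2) * 2
    n+3≡[m+2]*2 = solve-∀
    identity : ∀ m k′ → let n = suc (m + m); L = n + (n * suc k′ + 2) in 2 * n * (suc k′ + 1) + 4 + (m + 2) ≡ suc (L + (suc m + L))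
    identity = solve-∀

  strength : SuperEdgeMagicTotal G × SMStrength G (2 * n * (k + 1) + 4 + (n + 3) / 2)
  strength rewrite magic-strength = (_ , labeling) , labeling , λ _ → magic-constant-bound

theorem4p1 : (n k r : ℕ) → 3 ≤ n → ¬ (2 ∣ n) → 1 ≤ k → ¬ (2 ∣ r) → 1 ≤ r → r < n →
    SuperEdgeMagicTotal (GraphNKR n k r)
      × SMStrength (GraphNKR n k r) (2 * n * (k + 1) + 4 + (n + 3) / 2)
theorem4p1 n zero r _ _ () _ _ _
theorem4p1 n (suc k′) r _ 2∤n _ 2∤r _ r<n with parityView n | parityView r
... | even u | _ = ⊥-elim (2∤n (divides u (double≡*2 u)))
... | odd _ | even u = ⊥-elim (2∤r (divides u (double≡*2 u)))
... | odd M | odd j with e , refl ← m≤n⇒∃[o]m+o≡n (double-cancel-< {j} {M} (≤-pred r<n)) = Labelling.strength j e k′
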